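{- For all integers $n\ge 5$, $$\sum_{j=1}^{n}\chi^{(j,1^{n-j})}\big(5\,1^{n-5}\big)^2=\frac{n^4-22n^3+239n^2-1298n+2760}{16(2n-3)(2n-5)(2n-7)(2n-9)}\binom{2n-2}{n-1}.$$
   Context: For partitions $\lambda,\mu$ of $n$, $\chi^{\lambda}(\mu)$ is the value of the irreducible character of $S_n$ indexed by $\lambda$ on permutations of cycle type $\mu$. $(j,1^{n-j})$ is the hook shape with first row $j$ and $n-j$ rows of length $1$; $5\,1^{n-5}$ is the partition of $n$ with one part $5$ and $n-5$ parts $1$. -}

module Defs where

open import Data.Nat as ℕ using (ℕ; zero; suc; _+_; _∸_; _<ᵇ_; _≡ᵇ_; _≤ᵇ_)
open import Data.Integer as ℤ using (ℤ; +_; -_; 0ℤ; 1ℤ)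
open import Data.List using (List; []; _∷_; length; map; foldr; replicate; upTo)
open import Data.Bool.ListAction using (all; any)
open import Data.Bool using (Bool; true; false; if_then_else_; _∧_; not)

-- A partition is a weakly decreasing list of positive parts.
Partition : Set
Partition = List ℕ

-- Beta-set (first-column hook lengths) of a partition l₁ ≥ … ≥ λₖ:
-- βᵢ = λᵢ + (k − i), i = 1..k.
betaSet : Partition → List ℕ
betaSet [] = []
betaSet (l ∷ ls) = (l + length ls) ∷ betaSet ls

member : ℕ → List ℕ → Bool
member m = any (m ≡ᵇ_)

countBetween : ℕ → ℕ → List ℕ → ℕ
countBetween lo hi = foldr (λ c acc → if (lo <ᵇ c) ∧ (c <ᵇ hi) then suc acc else acc) 0

sgn : ℕ → ℤ
sgn zero = 1ℤ
sgn (suc zero) = - 1ℤ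
sgn (suc (suc k)) = sgn k

sumℤ : List ℤ → ℤ
sumℤ = foldr ℤ._+_ 0ℤ

moveBead : ℕ → ℕ → List ℕ → List ℕ
moveBead b b' = map (λ c → if c ≡ᵇ b then b' else c)

-- Murnaghan–Nakayama rule on beta-sets: removing a rim r-hook is moving a
-- bead from b to an empty position b − r, with sign (−1)^(#beads strictly
-- between b − r and b); leg length of the rim hook.
χβ : List ℕ → List ℕ → ℤ
χβ β [] = if all (λ b → b <ᵇ length β) β then 1ℤ else 0ℤ
χβ β (r ∷ μ) = sumℤ (map term β)
  where
  term : ℕ → ℤ
  term b = if (r ≤ᵇ b) ∧ not (member (b ∸ r) β)
           then sgn (countBetween (b ∸ r) b β) ℤ.* χβ (moveBead b (b ∸ r) β) μ
           else 0ℤ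

χ : Partition → Partition → ℤ
χ la μ = χβ (betaSet la) μ

hook : ℕ → ℕ → Partition
hook n j = j ∷ replicate (n ∸ j) 1

fiveCycleType : ℕ → Partition
fiveCycleType n = 5 ∷ replicate (n ∸ 5) 1

hookSquareSum : ℕ → ℤ
hookSquareSum n = sumℤ (map (λ j → χ (hook n j) (fiveCycleType n) ℤ.* χ (hook n j) (fiveCycleType n)) (map suc (upTo n)))

{-# OPTIONS --safe #-}
-- A hook (k + 1, 1^l) of n = m + 6 has β-set {n, l, …, 1}. In the Murnaghan–Nakayama recursion
-- a 5-hook is removed either from the arm, leaving the hook (m + 1 − l, 1^l) of m + 1, or (when
-- l ≥ 5) from the leg with sign (−1)^4, leaving (k + 1, 1^(l − 5)). Hooks of m + 1 have degree
-- C(m, leg), so the character value is C(m, l) + C(m, k) with k + l = m + 5, and Vandermonde's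
-- identity gives Σ χ² = 2 C(2m, m) + 2 C(2m, m + 5). Both C(2m, m + 5) and C(2m + 10, m + 5) are
-- C(2m, m) times a product of five ratios of neighbouring binomial coefficients; clearing the
-- denominator (m + 1)⋯(m + 5) reduces the claim to the polynomial identity
-- (2m + 1) P(m + 6) = (m + 1)⋯(m + 5) + m(m − 1)⋯(m − 4) for the quartic P of the statement.
-- The case n = 5 is a direct computation.
module Submission where

open import Defs

module Binomials where
  open import Data.Nat
  open import Data.Nat.Combinatorics using (_C_; nCk+nC[k+1]≡[n+1]C[k+1]; nCk≡nC[n∸k]; k>n⇒nCk≡0; nC1≡n)
  open import Data.Nat.Properties
  open import Data.Nat.Tactic.RingSolver using (solve-∀)
  open import Function using (_∘_)
  open import Relation.Binary.PropositionalEquality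
  open ≡-Reasoning

  pascal : ∀ n k → suc n C suc k ≡ n C k + n C suc k
  pascal n k = sym (nCk+nC[k+1]≡[n+1]C[k+1] n k)

  C-sym : ∀ {n k} → k ≤ n → n C (n ∸ k) ≡ n C k
  C-sym k≤n = sym (nCk≡nC[n∸k] k≤n)

  [k+l]Cl≡[k+l]Ck : ∀ k l → (k + l) C l ≡ (k + l) C k
  [k+l]Cl≡[k+l]Ck k l = trans (nCk≡nC[n∸k] (m≤n+m l k)) (cong ((k + l) C_) (m+n∸n≡m k l))

  [k+1]*[n+1]C[k+1]≡[n+1]*nCk : ∀ n k → suc k * (suc n C suc k) ≡ suc n * (n C k)
  [k+1]*[n+1]C[k+1]≡[n+1]*nCk zero zero = refl
  [k+1]*[n+1]C[k+1]≡[n+1]*nCk zero (suc k) = *-zeroʳ (suc (suc k))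
  [k+1]*[n+1]C[k+1]≡[n+1]*nCk (suc n) zero =
    trans (*-identityˡ _) (trans (nC1≡n (suc (suc n))) (sym (*-identityʳ (suc (suc n)))))
  [k+1]*[n+1]C[k+1]≡[n+1]*nCk (suc n) (suc k) = begin
    suc (suc k) * (suc (suc n) C suc (suc k))
      ≡⟨ cong (suc (suc k) *_) (pascal (suc n) (suc k)) ⟩
    suc (suc k) * (suc n C suc k + suc n C suc (suc k))
      ≡⟨ expand k (suc n C suc k) (suc n C suc (suc k)) ⟩
    suc k * (suc n C suc k) + suc n C suc k + suc (suc k) * (suc n C suc (suc k))
      ≡⟨ cong₂ (λ u v → u + suc n C suc k + v)
               ([k+1]*[n+1]C[k+1]≡[n+1]*nCk n k) ([k+1]*[n+1]C[k+1]≡[n+1]*nCk n (suc k)) ⟩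
    suc n * (n C k) + suc n C suc k + suc n * (n C suc k)
      ≡⟨ cong (λ u → suc n * (n C k) + u + suc n * (n C suc k)) (pascal n k) ⟩
    suc n * (n C k) + (n C k + n C suc k) + suc n * (n C suc k)
      ≡⟨ collect n (n C k) (n C suc k) ⟩
    suc (suc n) * (n C k + n C suc k)
      ≡⟨ cong (suc (suc n) *_) (sym (pascal n k)) ⟩
    suc (suc n) * (suc n C suc k) ∎
    where
    expand : ∀ k x y → suc (suc k) * (x + y) ≡ suc k * x + x + suc (suc k) * y
    expand = solve-∀
    collect : ∀ n x y → suc n * x + (x + y) + suc n * y ≡ suc (suc n) * (x + y)
    collect = solve-∀

  [k+1]*nC[k+1]+k*nCk≡n*nCk : ∀ n k → suc k * (n C suc k) + k * (n C k) ≡ n * (n C k)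
  [k+1]*nC[k+1]+k*nCk≡n*nCk n k = +-cancelˡ-≡ (n C k) _ _ (begin
    n C k + (suc k * (n C suc k) + k * (n C k))
      ≡⟨ regroup k (n C k) (n C suc k) ⟩
    suc k * (n C k + n C suc k)
      ≡⟨ cong (suc k *_) (sym (pascal n k)) ⟩
    suc k * (suc n C suc k)
      ≡⟨ [k+1]*[n+1]C[k+1]≡[n+1]*nCk n k ⟩
    suc n * (n C k) ∎)
    where
    regroup : ∀ k x y → x + (suc k * y + k * x) ≡ suc k * (x + y)
    regroup = solve-∀

  [j+1]*[2j+2]C[j+1]≡2*[2j+1]*[2j]Cj : ∀ j →
    suc j * ((suc j + suc j) C suc j) ≡ 2 * suc (j + j) * ((j + j) C j)
  [j+1]*[2j+2]C[j+1]≡2*[2j+1]*[2j]Cj j = begin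
    suc j * ((suc j + suc j) C suc j)
      ≡⟨ cong (λ n → suc j * (suc n C suc j)) (+-suc j j) ⟩
    suc j * (suc (suc (j + j)) C suc j)
      ≡⟨ cong (suc j *_) (pascal (suc (j + j)) j) ⟩
    suc j * (suc (j + j) C j + suc (j + j) C suc j)
      ≡⟨ cong (λ x → suc j * (x + suc (j + j) C suc j)) middle ⟩
    suc j * (suc (j + j) C suc j + suc (j + j) C suc j)
      ≡⟨ double (suc j) (suc (j + j) C suc j) ⟩
    2 * (suc j * (suc (j + j) C suc j))
      ≡⟨ cong (2 *_) ([k+1]*[n+1]C[k+1]≡[n+1]*nCk (j + j) j) ⟩
    2 * (suc (j + j) * ((j + j) C j))
      ≡⟨ sym (*-assoc 2 (suc (j + j)) _) ⟩
    2 * suc (j + j) * ((j + j) C j) ∎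
    where
    middle : suc (j + j) C j ≡ suc (j + j) C suc j
    middle = trans (nCk≡nC[n∸k] (m≤n⇒m≤1+n (m≤m+n j j)))
                   (cong (suc (j + j) C_) (trans (cong (_∸ j) (sym (+-suc j j))) (m+n∸m≡n j (suc j))))
    double : ∀ a x → a * (x + x) ≡ 2 * (a * x)
    double = solve-∀

  ∑ : ℕ → (ℕ → ℕ) → ℕ
  ∑ zero f = 0
  ∑ (suc n) f = f 0 + ∑ n (f ∘ suc)

  syntax ∑ n (λ k → e) = ∑[ k < n ] e

  ∑-cong : ∀ n {f g} → (∀ {k} → k < n → f k ≡ g k) → ∑ n f ≡ ∑ n g
  ∑-cong zero _ = refl
  ∑-cong (suc n) f≡g = cong₂ _+_ (f≡g z<s) (∑-cong n (f≡g ∘ s<s))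

  ∑-zero : ∀ n {f} → (∀ {k} → k < n → f k ≡ 0) → ∑ n f ≡ 0
  ∑-zero zero _ = refl
  ∑-zero (suc n) f≡0 = cong₂ _+_ (f≡0 z<s) (∑-zero n (f≡0 ∘ s<s))

  ∑-+ : ∀ n f g → ∑[ k < n ] (f k + g k) ≡ ∑ n f + ∑ n g
  ∑-+ zero f g = refl
  ∑-+ (suc n) f g = trans (cong (f 0 + g 0 +_) (∑-+ n (f ∘ suc) (g ∘ suc))) (interchange (f 0) (g 0) _ _)
    where
    interchange : ∀ a b c d → a + b + (c + d) ≡ a + c + (b + d)
    interchange = solve-∀

  ∑-*ˡ : ∀ n c f → ∑[ k < n ] (c * f k) ≡ c * ∑ n f
  ∑-*ˡ zero c f = sym (*-zeroʳ c)
  ∑-*ˡ (suc n) c f = trans (cong (c * f 0 +_) (∑-*ˡ n c (f ∘ suc))) (sym (*-distribˡ-+ c (f 0) _))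

  ∑-split : ∀ a b f → ∑ (a + b) f ≡ ∑ a f + ∑[ k < b ] f (a + k)
  ∑-split zero b f = refl
  ∑-split (suc a) b f = trans (cong (f 0 +_) (∑-split a b (f ∘ suc))) (sym (+-assoc (f 0) _ _))

  vandermonde : ∀ a b t → ∑[ k < suc t ] ((a C k) * (b C (t ∸ k))) ≡ (a + b) C t
  vandermonde zero b t = begin
    1 * (b C t) + ∑[ k < t ] ((0 C suc k) * (b C (t ∸ suc k)))
      ≡⟨ cong₂ _+_ (*-identityˡ (b C t)) (∑-zero t (λ _ → refl)) ⟩
    b C t + 0
      ≡⟨ +-identityʳ (b C t) ⟩
    b C t ∎
  vandermonde (suc a) b zero = refl
  vandermonde (suc a) b (suc t) = begin
    1 * (b C suc t) + ∑[ k < suc t ] ((suc a C suc k) * (b C (t ∸ k)))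
      ≡⟨ cong (1 * (b C suc t) +_) (∑-cong (suc t) (λ {k} _ → cong (_* (b C (t ∸ k))) (pascal a k))) ⟩
    1 * (b C suc t) + ∑[ k < suc t ] ((a C k + a C suc k) * (b C (t ∸ k)))
      ≡⟨ cong (1 * (b C suc t) +_)
              (trans (∑-cong (suc t) (λ {k} _ → *-distribʳ-+ (b C (t ∸ k)) (a C k) (a C suc k)))
                     (∑-+ (suc t) (λ k → (a C k) * (b C (t ∸ k))) (λ k → (a C suc k) * (b C (t ∸ k))))) ⟩
    1 * (b C suc t) + (∑[ k < suc t ] ((a C k) * (b C (t ∸ k))) + ∑[ k < suc t ] ((a C suc k) * (b C (t ∸ k))))
      ≡⟨ +-exchange (1 * (b C suc t)) (∑[ k < suc t ] ((a C k) * (b C (t ∸ k)))) _ ⟩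
    ∑[ k < suc t ] ((a C k) * (b C (t ∸ k))) + ∑[ k < suc (suc t) ] ((a C k) * (b C (suc t ∸ k)))
      ≡⟨ cong₂ _+_ (vandermonde a b t) (vandermonde a b (suc t)) ⟩
    (a + b) C t + (a + b) C suc t
      ≡⟨ sym (pascal (a + b) t) ⟩
    suc (a + b) C suc t ∎
    where
    +-exchange : ∀ x y z → x + (y + z) ≡ y + (x + z)
    +-exchange = solve-∀

  ∑-binomial² : ∀ m → ∑[ k < suc m ] ((m C k) * (m C k)) ≡ (m + m) C m
  ∑-binomial² m =
    trans (∑-cong (suc m) (λ {k} k<1+m → cong ((m C k) *_) (sym (C-sym (≤-pred k<1+m))))) (vandermonde m m m)

  ∑-binomial²-padded : ∀ r m → ∑[ k < suc (r + m) ] ((m C k) * (m C k)) ≡ (m + m) C m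
  ∑-binomial²-padded r m = begin
    ∑[ k < suc (r + m) ] ((m C k) * (m C k))
      ≡⟨ cong (λ n → ∑[ k < suc n ] ((m C k) * (m C k))) (+-comm r m) ⟩
    ∑[ k < suc m + r ] ((m C k) * (m C k))
      ≡⟨ ∑-split (suc m) r (λ k → (m C k) * (m C k)) ⟩
    ∑[ k < suc m ] ((m C k) * (m C k)) + ∑[ k < r ] ((m C (suc m + k)) * (m C (suc m + k)))
      ≡⟨ cong₂ _+_ (∑-binomial² m)
                   (∑-zero r (λ {k} _ → cong (λ z → z * z) (k>n⇒nCk≡0 (s≤s (m≤m+n m k))))) ⟩
    (m + m) C m + 0
      ≡⟨ +-identityʳ _ ⟩
    (m + m) C m ∎

  ∑-binomial²-reversed : ∀ r m → ∑[ k < suc (r + m) ] ((m C (r + m ∸ k)) * (m C (r + m ∸ k))) ≡ (m + m) C m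
  ∑-binomial²-reversed r m = begin
    ∑[ k < suc (r + m) ] (x k * x k)
      ≡⟨ cong (λ n → ∑[ k < n ] (x k * x k)) (sym (+-suc r m)) ⟩
    ∑[ k < r + suc m ] (x k * x k)
      ≡⟨ ∑-split r (suc m) (λ k → x k * x k) ⟩
    ∑[ k < r ] (x k * x k) + ∑[ k < suc m ] (x (r + k) * x (r + k))
      ≡⟨ cong₂ _+_ (∑-zero r (λ k<r → cong (λ z → z * z) (k>n⇒nCk≡0 (m<r+m∸k k<r))))
                   (∑-cong (suc m) (λ {k} k<1+m → cong (λ z → z * z) (x[r+k]≡mCk (≤-pred k<1+m)))) ⟩
    0 + ∑[ k < suc m ] ((m C k) * (m C k))
      ≡⟨ ∑-binomial² m ⟩
    (m + m) C m ∎
    where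
    x : ℕ → ℕ
    x k = m C (r + m ∸ k)
    m<r+m∸k : ∀ {k} → k < r → m < r + m ∸ k
    m<r+m∸k k<r = subst (m <_) (sym (+-∸-comm m (<⇒≤ k<r))) (m<n+m m (m<n⇒0<n∸m k<r))
    x[r+k]≡mCk : ∀ {k} → k ≤ m → x (r + k) ≡ m C k
    x[r+k]≡mCk {k} k≤m = trans (cong (m C_) ([m+n]∸[m+o]≡n∸o r m k)) (C-sym k≤m)

  ∑-hookSquares : ∀ r m →
    ∑[ k < suc (r + m) ] ((m C (r + m ∸ k) + m C k) * (m C (r + m ∸ k) + m C k))
      ≡ 2 * ((m + m) C m + (m + m) C (r + m))
  ∑-hookSquares r m = begin
    ∑[ k < suc N ] ((x k + y k) * (x k + y k))
      ≡⟨ ∑-cong (suc N) (λ {k} _ → square-expand (x k) (y k)) ⟩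
    ∑[ k < suc N ] (x k * x k + (y k * y k + 2 * (y k * x k)))
      ≡⟨ ∑-+ (suc N) (λ k → x k * x k) (λ k → y k * y k + 2 * (y k * x k)) ⟩
    ∑[ k < suc N ] (x k * x k) + ∑[ k < suc N ] (y k * y k + 2 * (y k * x k))
      ≡⟨ cong (∑[ k < suc N ] (x k * x k) +_) (∑-+ (suc N) (λ k → y k * y k) (λ k → 2 * (y k * x k))) ⟩
    ∑[ k < suc N ] (x k * x k) + (∑[ k < suc N ] (y k * y k) + ∑[ k < suc N ] (2 * (y k * x k)))
      ≡⟨ cong₂ (λ u v → u + (v + ∑[ k < suc N ] (2 * (y k * x k))))
               (∑-binomial²-reversed r m) (∑-binomial²-padded r m) ⟩
    (m + m) C m + ((m + m) C m + ∑[ k < suc N ] (2 * (y k * x k)))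
      ≡⟨ cong (λ w → (m + m) C m + ((m + m) C m + w))
              (trans (∑-*ˡ (suc N) 2 (λ k → y k * x k)) (cong (2 *_) (vandermonde m m N))) ⟩
    (m + m) C m + ((m + m) C m + 2 * ((m + m) C N))
      ≡⟨ collect ((m + m) C m) ((m + m) C N) ⟩
    2 * ((m + m) C m + (m + m) C N) ∎
    where
    N = r + m
    x y : ℕ → ℕ
    x k = m C (N ∸ k)
    y k = m C k
    square-expand : ∀ a b → (a + b) * (a + b) ≡ a * a + (b * b + 2 * (b * a))
    square-expand = solve-∀
    collect : ∀ a b → a + (a + 2 * b) ≡ 2 * (a + b)
    collect = solve-∀

module HookCharacters where
  open import Data.Bool using (Bool; true; false; _∧_; _∨_; not; if_then_else_)
  open import Data.Bool.ListAction using (all)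
  open import Data.Bool.Properties using (∧-zeroʳ; ∨-zeroʳ)
  open import Data.Empty using (⊥-elim)
  open import Data.Integer as ℤ using (ℤ; +_; 0ℤ; 1ℤ)
  import Data.Integer.Properties as ℤ
  open import Data.List using (List; []; _∷_; _++_; length; map; replicate; applyUpTo; upTo)
  open import Data.List.Membership.Propositional using (_∈_; _∉_)
  open import Data.List.Membership.Propositional.Properties using (∈-++⁺ˡ; ∈-++⁺ʳ; ∈-++⁻)
  open import Data.List.Properties using (map-++; ++-identityʳ; length-replicate; map-applyUpTo)
  open import Data.List.Relation.Unary.Any using (here; there)
  open import Data.Nat
  open import Data.Nat.Combinatorics using (_C_; nCk+nC[k+1]≡[n+1]C[k+1]; nCn≡1; k>n⇒nCk≡0)
  open import Data.Nat.Properties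
  open import Data.Nat.Tactic.RingSolver using (solve)
  open import Data.Product using (_×_; _,_; proj₁; proj₂; ∃-syntax)
  open import Data.Sum using (_⊎_; inj₁; inj₂; [_,_]′)
  open import Function using (_∘_; id)
  open import Relation.Binary.PropositionalEquality
  open import Relation.Nullary using (Dec; yes; no)
  open ≡-Reasoning
  open Binomials using (∑; ∑-hookSquares; [k+l]Cl≡[k+l]Ck)

  <ᵇ-true : ∀ {m n} → m < n → (m <ᵇ n) ≡ true
  <ᵇ-true {zero} {suc n} _ = refl
  <ᵇ-true {suc m} {suc n} (s≤s m<n) = <ᵇ-true m<n

  <ᵇ-false : ∀ {m n} → n ≤ m → (m <ᵇ n) ≡ false
  <ᵇ-false {m} {zero} _ = refl
  <ᵇ-false {suc m} {suc n} (s≤s n≤m) = <ᵇ-false n≤m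

  ≤ᵇ-true : ∀ {m n} → m ≤ n → (m ≤ᵇ n) ≡ true
  ≤ᵇ-true z≤n = refl
  ≤ᵇ-true (s≤s m≤n) = <ᵇ-true (s≤s m≤n)

  ≤ᵇ-false : ∀ {m n} → n < m → (m ≤ᵇ n) ≡ false
  ≤ᵇ-false (s≤s n≤m) = <ᵇ-false n≤m

  ≡ᵇ-refl : ∀ m → (m ≡ᵇ m) ≡ true
  ≡ᵇ-refl zero = refl
  ≡ᵇ-refl (suc m) = ≡ᵇ-refl m

  ≡ᵇ-false : ∀ {m n} → m ≢ n → (m ≡ᵇ n) ≡ false
  ≡ᵇ-false {zero} {zero} m≢n = ⊥-elim (m≢n refl)
  ≡ᵇ-false {zero} {suc n} _ = refl
  ≡ᵇ-false {suc m} {zero} _ = refl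
  ≡ᵇ-false {suc m} {suc n} m≢n = ≡ᵇ-false (m≢n ∘ cong suc)

  member-true : ∀ {x xs} → x ∈ xs → member x xs ≡ true
  member-true {x} {_ ∷ xs} (here refl) = cong (_∨ member x xs) (≡ᵇ-refl x)
  member-true {x} {y ∷ _} (there x∈xs) = trans (cong ((x ≡ᵇ y) ∨_) (member-true x∈xs)) (∨-zeroʳ _)

  member-false : ∀ {x xs} → x ∉ xs → member x xs ≡ false
  member-false {xs = []} _ = refl
  member-false {x} {y ∷ xs} x∉ with x ≟ y
  ... | yes refl = ⊥-elim (x∉ (here refl))
  ... | no x≢y rewrite ≡ᵇ-false x≢y = member-false (x∉ ∘ there)

  ∉-∷ : ∀ {x y : ℕ} {xs} → x ≢ y → x ∉ xs → x ∉ y ∷ xs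
  ∉-∷ x≢y _ (here x≡y) = x≢y x≡y
  ∉-∷ _ x∉xs (there x∈xs) = x∉xs x∈xs

  ∉-++ : ∀ {x : ℕ} xs {ys} → x ∉ xs → x ∉ ys → x ∉ xs ++ ys
  ∉-++ xs x∉xs x∉ys x∈ = [ x∉xs , x∉ys ]′ (∈-++⁻ xs x∈)

  all-true : ∀ (P : ℕ → Bool) xs → (∀ {x} → x ∈ xs → P x ≡ true) → all P xs ≡ true
  all-true P [] _ = refl
  all-true P (x ∷ xs) P-true rewrite P-true (here refl) = all-true P xs (P-true ∘ there)

  sumℤ-++ : ∀ (f : ℕ → ℤ) xs ys → sumℤ (map f (xs ++ ys)) ≡ sumℤ (map f xs) ℤ.+ sumℤ (map f ys)
  sumℤ-++ f [] ys = sym (ℤ.+-identityˡ _)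
  sumℤ-++ f (x ∷ xs) ys = trans (cong (ℤ._+_ (f x)) (sumℤ-++ f xs ys)) (sym (ℤ.+-assoc (f x) _ _))

  sumℤ-zero : ∀ (f : ℕ → ℤ) xs → (∀ {x} → x ∈ xs → f x ≡ 0ℤ) → sumℤ (map f xs) ≡ 0ℤ
  sumℤ-zero f [] _ = refl
  sumℤ-zero f (x ∷ xs) f≡0 = cong₂ ℤ._+_ (f≡0 (here refl)) (sumℤ-zero f xs (f≡0 ∘ there))

  sumℤ-++-zeroˡ : ∀ (f : ℕ → ℤ) xs ys → (∀ {x} → x ∈ xs → f x ≡ 0ℤ) →
                  sumℤ (map f (xs ++ ys)) ≡ sumℤ (map f ys)
  sumℤ-++-zeroˡ f xs ys f≡0 =
    trans (sumℤ-++ f xs ys) (trans (cong (ℤ._+ _) (sumℤ-zero f xs f≡0)) (ℤ.+-identityˡ _))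

  interval : ℕ → ℕ → List ℕ
  interval s zero = []
  interval s (suc c) = s + c ∷ interval s c

  length-interval : ∀ s c → length (interval s c) ≡ c
  length-interval s zero = refl
  length-interval s (suc c) = cong suc (length-interval s c)

  interval-suc-++ : ∀ s c L → interval s (suc c) ++ L ≡ interval (suc s) c ++ (s ∷ L)
  interval-suc-++ s zero L = cong (_∷ L) (+-identityʳ s)
  interval-suc-++ s (suc c) L = cong₂ _∷_ (+-suc s c) (interval-suc-++ s c L)

  interval-+ : ∀ s c d → interval s (c + d) ≡ interval (s + d) c ++ interval s d
  interval-+ s zero d = refl
  interval-+ s (suc c) d =
    cong₂ _∷_ (trans (cong (_+_ s) (+-comm c d)) (sym (+-assoc s d c))) (interval-+ s c d)

  ∈-interval⁺ : ∀ {x} s c → s ≤ x → x < s + c → x ∈ interval s c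
  ∈-interval⁺ {x} s zero s≤x x<s+0 = ⊥-elim (<⇒≱ x<s+0 (subst (_≤ x) (sym (+-identityʳ s)) s≤x))
  ∈-interval⁺ {x} s (suc c) s≤x x<s+1+c with x ≟ s + c
  ... | yes refl = here refl
  ... | no x≢s+c = there (∈-interval⁺ s c s≤x x<s+c)
    where
    x<s+c : x < s + c
    x<s+c = ≤∧≢⇒< (≤-pred (≤-trans x<s+1+c (≤-reflexive (+-suc s c)))) x≢s+c

  ∈-interval⁻ : ∀ {x} s c → x ∈ interval s c → s ≤ x × x < s + c
  ∈-interval⁻ s (suc c) (here refl) = m≤m+n s c , +-monoʳ-< s (n<1+n c)
  ∈-interval⁻ s (suc c) (there x∈) with ∈-interval⁻ s c x∈
  ... | s≤x , x<s+c = s≤x , ≤-trans x<s+c (+-monoʳ-≤ s (n≤1+n c))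

  ∉-interval-< : ∀ {x} s c → x < s → x ∉ interval s c
  ∉-interval-< s c x<s x∈ = <⇒≱ x<s (proj₁ (∈-interval⁻ s c x∈))

  ∉-interval-≥ : ∀ {x} s c → s + c ≤ x → x ∉ interval s c
  ∉-interval-≥ s c s+c≤x x∈ = <⇒≱ (proj₂ (∈-interval⁻ s c x∈)) s+c≤x

  ∈-interval⇒offset : ∀ {x} s c → x ∈ interval s c → ∃[ i ] i < c × s + i ≡ x
  ∈-interval⇒offset s (suc c) (here refl) = c , n<1+n c , refl
  ∈-interval⇒offset s (suc c) (there x∈) with ∈-interval⇒offset s c x∈
  ... | i , i<c , s+i≡x = i , m<n⇒m<1+n i<c , s+i≡x

  record IsInitialSegment (g : ℕ) (L : List ℕ) : Set where
    field
      length≡ : length L ≡ g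
      ∈⇒< : ∀ {x} → x ∈ L → x < g
      <⇒∈ : ∀ {x} → x < g → x ∈ L

    ∉-≥ : ∀ {x} → g ≤ x → x ∉ L
    ∉-≥ g≤x x∈L = <⇒≱ (∈⇒< x∈L) g≤x

  open IsInitialSegment

  initialSegment-[] : IsInitialSegment 0 []
  initialSegment-[] = record { length≡ = refl ; ∈⇒< = λ () ; <⇒∈ = λ () }

  initialSegment-∷ : ∀ {g L} → IsInitialSegment g L → IsInitialSegment (suc g) (g ∷ L)
  initialSegment-∷ {g} seg = record
    { length≡ = cong suc (length≡ seg)
    ; ∈⇒< = λ { (here refl) → n<1+n g ; (there x∈L) → m<n⇒m<1+n (∈⇒< seg x∈L) }
    ; <⇒∈ = λ x<g+1 → [ there ∘ <⇒∈ seg , here ]′ (m<1+n⇒m<n∨m≡n x<g+1)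
    }

  initialSegment-0∷interval : ∀ c → IsInitialSegment (suc c) (0 ∷ interval 1 c)
  initialSegment-0∷interval c = record
    { length≡ = cong suc (length-interval 1 c)
    ; ∈⇒< = λ { (here refl) → s≤s z≤n ; (there x∈) → proj₂ (∈-interval⁻ 1 c x∈) }
    ; <⇒∈ = λ { {zero} _ → here refl ; {suc x} x<c+1 → there (∈-interval⁺ 1 c (s≤s z≤n) x<c+1) }
    }

  χβ-initialSegment : ∀ {g L} → IsInitialSegment g L → χβ L [] ≡ 1ℤ
  χβ-initialSegment {L = L} seg with length≡ seg
  ... | refl rewrite all-true (_<ᵇ length L) L (<ᵇ-true ∘ ∈⇒< seg) = refl

  moveBead-∉ : ∀ {b} b′ xs → b ∉ xs → moveBead b b′ xs ≡ xs
  moveBead-∉ b′ [] _ = refl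
  moveBead-∉ {b} b′ (x ∷ xs) b∉ with x ≟ b
  ... | yes refl = ⊥-elim (b∉ (here refl))
  ... | no x≢b rewrite ≡ᵇ-false x≢b = cong (x ∷_) (moveBead-∉ b′ xs (b∉ ∘ there))

  moveBead-head : ∀ {b} b′ xs → b ∉ xs → moveBead b b′ (b ∷ xs) ≡ b′ ∷ xs
  moveBead-head {b} b′ xs b∉ rewrite ≡ᵇ-refl b = cong (b′ ∷_) (moveBead-∉ b′ xs b∉)

  countBetween-∷-outside : ∀ lo hi {x} xs → x ≤ lo ⊎ hi ≤ x →
                           countBetween lo hi (x ∷ xs) ≡ countBetween lo hi xs
  countBetween-∷-outside lo hi xs (inj₁ x≤lo) rewrite <ᵇ-false x≤lo = refl
  countBetween-∷-outside lo hi {x} xs (inj₂ hi≤x) rewrite <ᵇ-false hi≤x | ∧-zeroʳ (lo <ᵇ x) = refl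

  countBetween-none : ∀ lo hi xs → (∀ {x} → x ∈ xs → x ≤ lo ⊎ hi ≤ x) → countBetween lo hi xs ≡ 0
  countBetween-none lo hi [] _ = refl
  countBetween-none lo hi (x ∷ xs) outside =
    trans (countBetween-∷-outside lo hi xs (outside (here refl))) (countBetween-none lo hi xs (outside ∘ there))

  countBetween-++ : ∀ lo hi xs ys →
                    countBetween lo hi (xs ++ ys) ≡ countBetween lo hi xs + countBetween lo hi ys
  countBetween-++ lo hi [] ys = refl
  countBetween-++ lo hi (x ∷ xs) ys with (lo <ᵇ x) ∧ (x <ᵇ hi)
  ... | true = cong suc (countBetween-++ lo hi xs ys)
  ... | false = countBetween-++ lo hi xs ys

  countBetween-all : ∀ lo hi xs → (∀ {x} → x ∈ xs → lo < x × x < hi) → countBetween lo hi xs ≡ length xs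
  countBetween-all lo hi [] _ = refl
  countBetween-all lo hi (x ∷ xs) inside with inside (here refl)
  ... | lo<x , x<hi rewrite <ᵇ-true lo<x | <ᵇ-true x<hi =
    cong suc (countBetween-all lo hi xs (inside ∘ there))

  -- The summand in Defs.χβ, so that χβ β (r ∷ μ) unfolds to sumℤ (map (removalTerm β r μ) β).
  removalTerm : List ℕ → ℕ → List ℕ → ℕ → ℤ
  removalTerm β r μ b =
    if (r ≤ᵇ b) ∧ not (member (b ∸ r) β)
    then sgn (countBetween (b ∸ r) b β) ℤ.* χβ (moveBead b (b ∸ r) β) μ
    else 0ℤ

  removalTerm-< : ∀ β r μ {b} → b < r → removalTerm β r μ b ≡ 0ℤ
  removalTerm-< β r μ b<r rewrite ≤ᵇ-false b<r = refl

  removalTerm-blocked : ∀ β r μ {b d} → d + r ≡ b → d ∈ β → removalTerm β r μ b ≡ 0ℤ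
  removalTerm-blocked β r μ {d = d} refl d∈β
    rewrite m+n∸n≡m d r | member-true d∈β | ∧-zeroʳ (r ≤ᵇ d + r) = refl

  removalTerm-move : ∀ β r μ {b d} → d + r ≡ b → d ∉ β →
    removalTerm β r μ b ≡ sgn (countBetween d b β) ℤ.* χβ (moveBead b d β) μ
  removalTerm-move β r μ {d = d} refl d∉β
    rewrite m+n∸n≡m d r | member-false d∉β | ≤ᵇ-true (m≤n+m r d) = refl

  removalTerm-adjacent : ∀ β μ {b} → b ∉ β → removalTerm β 1 μ (suc b) ≡ χβ (moveBead (suc b) b β) μ
  removalTerm-adjacent β μ {b} b∉β = begin
    removalTerm β 1 μ (suc b)
      ≡⟨ removalTerm-move β 1 μ (+-comm b 1) b∉β ⟩
    sgn (countBetween b (suc b) β) ℤ.* χβ (moveBead (suc b) b β) μ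
      ≡⟨ cong (λ c → sgn c ℤ.* χβ (moveBead (suc b) b β) μ)
              (countBetween-none b (suc b) β (λ {x} _ → ≤-<-connex x b)) ⟩
    1ℤ ℤ.* χβ (moveBead (suc b) b β) μ
      ≡⟨ ℤ.*-identityˡ _ ⟩
    χβ (moveBead (suc b) b β) μ ∎

  removalTerm-top : ∀ {t} xs μ → t ∉ xs → suc t ∉ xs →
                    removalTerm (suc t ∷ xs) 1 μ (suc t) ≡ χβ (t ∷ xs) μ
  removalTerm-top {t} xs μ t∉xs t+1∉xs =
    trans (removalTerm-adjacent (suc t ∷ xs) μ (∉-∷ (<⇒≢ (n<1+n t)) t∉xs))
          (cong (λ β → χβ β μ) (moveBead-head t xs t+1∉xs))

  removalTerms-initialSegment : ∀ β μ {g L} → IsInitialSegment g L → (∀ {x} → x ∈ L → x ∈ β) →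
                                sumℤ (map (removalTerm β 1 μ) L) ≡ 0ℤ
  removalTerms-initialSegment β μ {L = L} seg L⊆β = sumℤ-zero (removalTerm β 1 μ) L blocked
    where
    blocked : ∀ {x} → x ∈ L → removalTerm β 1 μ x ≡ 0ℤ
    blocked {zero} _ = removalTerm-< β 1 μ (s≤s z≤n)
    blocked {suc x} x+1∈L =
      removalTerm-blocked β 1 μ (+-comm x 1) (L⊆β (<⇒∈ seg (<-trans (n<1+n x) (∈⇒< seg x+1∈L))))

  ∉-hookTail : ∀ {g L x} p → IsInitialSegment g L → suc g + p ≤ x → x ∉ interval (suc g) p ++ L
  ∉-hookTail {g} p seg g+1+p≤x =
    ∉-++ (interval (suc g) p) (∉-interval-≥ (suc g) p g+1+p≤x)
      (∉-≥ seg (≤-trans (n≤1+n g) (≤-trans (m≤m+n (suc g) p) g+1+p≤x)))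

  moveBead-hookTail : ∀ t p {g L} → IsInitialSegment g L → suc g < t →
    moveBead (suc g) g (t ∷ (interval (suc g) (suc p) ++ L)) ≡ t ∷ (interval (suc (suc g)) p ++ (g ∷ L))
  moveBead-hookTail t p {g} {L} seg g+1<t = begin
    moveBead (suc g) g (t ∷ (interval (suc g) (suc p) ++ L))
      ≡⟨ cong (λ xs → moveBead (suc g) g (t ∷ xs)) (interval-suc-++ (suc g) p L) ⟩
    moveBead (suc g) g ((t ∷ upper) ++ (suc g ∷ L))
      ≡⟨ map-++ _ (t ∷ upper) (suc g ∷ L) ⟩
    moveBead (suc g) g (t ∷ upper) ++ moveBead (suc g) g (suc g ∷ L)
      ≡⟨ cong₂ _++_ (moveBead-∉ g (t ∷ upper) (∉-∷ (<⇒≢ g+1<t) (∉-interval-< (suc (suc g)) p ≤-refl)))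
                    (moveBead-head g L (∉-≥ seg (n≤1+n g))) ⟩
    t ∷ (upper ++ (g ∷ L)) ∎
    where
    upper = interval (suc (suc g)) p

  removalTerms-hookTail : ∀ t p {g L} μ → IsInitialSegment g L → suc g + p < t →
    sumℤ (map (removalTerm (t ∷ (interval (suc g) (suc p) ++ L)) 1 μ) (interval (suc g) (suc p) ++ L))
      ≡ χβ (t ∷ (interval (suc (suc g)) p ++ (g ∷ L))) μ
  removalTerms-hookTail t p {g} {L} μ seg g+1+p<t = begin
    sumℤ (map f (interval (suc g) (suc p) ++ L))
      ≡⟨ cong (sumℤ ∘ map f) (interval-suc-++ (suc g) p L) ⟩
    sumℤ (map f (upper ++ (suc g ∷ L)))
      ≡⟨ sumℤ-++-zeroˡ f upper (suc g ∷ L) upper-blocked ⟩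
    f (suc g) ℤ.+ sumℤ (map f L)
      ≡⟨ cong₂ ℤ._+_ (removalTerm-adjacent β μ g∉β)
                     (removalTerms-initialSegment β μ seg (there ∘ ∈-++⁺ʳ (interval (suc g) (suc p)))) ⟩
    χβ (moveBead (suc g) g β) μ ℤ.+ 0ℤ
      ≡⟨ ℤ.+-identityʳ _ ⟩
    χβ (moveBead (suc g) g β) μ
      ≡⟨ cong (λ β′ → χβ β′ μ) (moveBead-hookTail t p seg g+1<t) ⟩
    χβ (t ∷ (upper ++ (g ∷ L))) μ ∎
    where
    upper = interval (suc (suc g)) p
    β = t ∷ (interval (suc g) (suc p) ++ L)
    f = removalTerm β 1 μ

    g+1<t : suc g < t
    g+1<t = <-≤-trans (s≤s (m≤m+n (suc g) p)) g+1+p<t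

    upper-blocked : ∀ {x} → x ∈ upper → f x ≡ 0ℤ
    upper-blocked x∈upper with ∈-interval⁻ (suc (suc g)) p x∈upper
    ... | s≤s g+1≤x , s≤s x<g+1+p = removalTerm-blocked β 1 μ (+-comm _ 1)
      (there (∈-++⁺ˡ (∈-interval⁺ (suc g) (suc p) g+1≤x (<-≤-trans x<g+1+p (+-monoʳ-≤ (suc g) (n≤1+n p))))))

    g∉β : g ∉ β
    g∉β = ∉-∷ (<⇒≢ (<-trans (n<1+n g) g+1<t))
            (∉-++ (interval (suc g) (suc p)) (∉-interval-< (suc g) (suc p) (n<1+n g)) (∉-≥ seg ≤-refl))

  -- t ∷ (interval (1 + g) p ++ L) is the β-set of the hook (a + 1, 1^p) followed by g zero parts.
  hookDegree : ∀ k a p {g L} t → IsInitialSegment g L → t ≡ suc a + p + g → k ≡ a + p →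
               χβ (t ∷ (interval (suc g) p ++ L)) (replicate (suc k) 1) ≡ + (k C p)
  hookDegree zero zero zero {g} {L} _ seg refl refl = begin
    χβ β (1 ∷ [])
      ≡⟨⟩
    removalTerm β 1 [] (suc g) ℤ.+ sumℤ (map (removalTerm β 1 []) L)
      ≡⟨ cong₂ ℤ._+_ (removalTerm-top L [] (∉-≥ seg ≤-refl) (∉-≥ seg (n≤1+n g)))
                     (removalTerms-initialSegment β [] seg there) ⟩
    χβ (g ∷ L) [] ℤ.+ 0ℤ
      ≡⟨ cong (ℤ._+ 0ℤ) (χβ-initialSegment (initialSegment-∷ seg)) ⟩
    + 1 ∎
    where
    β = suc g ∷ L
  hookDegree zero (suc a) p _ _ _ ()
  hookDegree zero zero (suc p) _ _ _ ()
  hookDegree (suc k) zero zero _ _ _ ()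
  hookDegree (suc .(a + 0)) (suc a) zero {g} {L} _ seg refl refl = begin
    χβ β (1 ∷ μ)
      ≡⟨⟩
    removalTerm β 1 μ (suc t) ℤ.+ sumℤ (map (removalTerm β 1 μ) L)
      ≡⟨ cong₂ ℤ._+_ (removalTerm-top L μ (∉-≥ seg g≤t) (∉-≥ seg (m≤n⇒m≤1+n g≤t)))
                     (removalTerms-initialSegment β μ seg there) ⟩
    χβ (t ∷ L) μ ℤ.+ 0ℤ
      ≡⟨ ℤ.+-identityʳ _ ⟩
    χβ (t ∷ L) μ
      ≡⟨ hookDegree (a + 0) a zero t seg refl refl ⟩
    + 1 ∎
    where
    t = suc a + 0 + g
    β = suc t ∷ L
    μ = replicate (suc (a + 0)) 1
    g≤t : g ≤ t
    g≤t = m≤n+m g (suc a + 0)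
  hookDegree (suc .(a + suc p)) (suc a) (suc p) {g} {L} _ seg refl refl = begin
    χβ β (1 ∷ μ)
      ≡⟨⟩
    removalTerm β 1 μ (suc t) ℤ.+ sumℤ (map (removalTerm β 1 μ) tail)
      ≡⟨ cong₂ ℤ._+_ (removalTerm-top tail μ (∉-hookTail (suc p) seg g+p+2≤t)
                                             (∉-hookTail (suc p) seg (m≤n⇒m≤1+n g+p+2≤t)))
                     (removalTerms-hookTail (suc t) p μ seg
                        (s≤s (≤-trans (+-monoʳ-≤ (suc g) (n≤1+n p)) g+p+2≤t))) ⟩
    χβ (t ∷ tail) μ ℤ.+ χβ (suc t ∷ (interval (suc (suc g)) p ++ (g ∷ L))) μ
      ≡⟨ cong₂ ℤ._+_ (hookDegree (a + suc p) a (suc p) t seg refl refl)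
                     (hookDegree (a + suc p) (suc a) p (suc t) (initialSegment-∷ seg) t+1≡ (+-suc a p)) ⟩
    + ((a + suc p) C suc p) ℤ.+ + ((a + suc p) C p)
      ≡⟨ cong +_ (trans (+-comm ((a + suc p) C suc p) _) (nCk+nC[k+1]≡[n+1]C[k+1] (a + suc p) p)) ⟩
    + (suc (a + suc p) C suc p) ∎
    where
    t = suc a + suc p + g
    tail = interval (suc g) (suc p) ++ L
    β = suc t ∷ tail
    μ = replicate (suc (a + suc p)) 1
    t≡ : a + (suc g + suc p) ≡ suc a + suc p + g
    t≡ = solve (a ∷ p ∷ g ∷ [])
    g+p+2≤t : suc g + suc p ≤ t
    g+p+2≤t = subst (suc g + suc p ≤_) t≡ (m≤n+m (suc g + suc p) a)
    t+1≡ : suc (suc a + suc p + g) ≡ suc (suc a) + p + suc g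
    t+1≡ = solve (a ∷ p ∷ g ∷ [])
  hookDegree (suc k) zero (suc .k) {g} {L} _ seg refl refl = begin
    χβ β (1 ∷ μ)
      ≡⟨⟩
    removalTerm β 1 μ t ℤ.+ sumℤ (map (removalTerm β 1 μ) tail)
      ≡⟨ cong₂ ℤ._+_ (removalTerm-blocked β 1 μ t-1+1≡t (there (here refl)))
                     (removalTerms-hookTail t k μ seg (s≤s (s≤s (≤-reflexive (+-comm g k))))) ⟩
    0ℤ ℤ.+ χβ (t ∷ (interval (suc (suc g)) k ++ (g ∷ L))) μ
      ≡⟨ ℤ.+-identityˡ _ ⟩
    χβ (t ∷ (interval (suc (suc g)) k ++ (g ∷ L))) μ
      ≡⟨ hookDegree k zero k t (initialSegment-∷ seg) (cong suc (sym (+-suc k g))) refl ⟩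
    + (k C k)
      ≡⟨ cong +_ (trans (nCn≡1 k) (sym (nCn≡1 (suc k)))) ⟩
    + (suc k C suc k) ∎
    where
    t = suc (suc (k + g))
    tail = interval (suc g) (suc k) ++ L
    β = t ∷ tail
    μ = replicate (suc k) 1
    t-1+1≡t : suc g + k + 1 ≡ suc (suc (k + g))
    t-1+1≡t = solve (g ∷ k ∷ [])

  -- suc k + l ∷ interval 1 l is the β-set of the hook (k + 1, 1^l).
  hookCharacter-arm : ∀ c k l m → k + l ≡ suc c + m →
    removalTerm (suc k + l ∷ interval 1 l) (suc c) (replicate (suc m) 1) (suc k + l) ≡ + (m C l)
  hookCharacter-arm c k l m k+l≡ = armTerm (l ≤? m)
    where
    head = suc k + l
    β = head ∷ interval 1 l
    μ = replicate (suc m) 1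

    target≡ : suc m + suc c ≡ head
    target≡ = trans (+-comm (suc m) (suc c)) (trans (+-suc (suc c) m) (cong suc (sym k+l≡)))

    armTerm : Dec (l ≤ m) → removalTerm β (suc c) μ head ≡ + (m C l)
    armTerm (no l≰m) =
      trans (removalTerm-blocked β (suc c) μ target≡ (there (∈-interval⁺ 1 l (s≤s z≤n) (s≤s (≰⇒> l≰m)))))
            (cong +_ (sym (k>n⇒nCk≡0 (≰⇒> l≰m))))
    armTerm (yes l≤m) = begin
      removalTerm β (suc c) μ head
        ≡⟨ removalTerm-move β (suc c) μ target≡ (∉-∷ (<⇒≢ m+1<head) (∉-interval-≥ 1 l (s≤s l≤m))) ⟩
      sgn (countBetween (suc m) head β) ℤ.* χβ (moveBead head (suc m) β) μ
        ≡⟨ cong₂ (λ n β′ → sgn n ℤ.* χβ β′ μ)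
                 (countBetween-none (suc m) head β outside)
                 (moveBead-head (suc m) (interval 1 l) (∉-interval-≥ 1 l (s≤s (m≤n+m l k)))) ⟩
      1ℤ ℤ.* χβ (suc m ∷ interval 1 l) μ
        ≡⟨ ℤ.*-identityˡ _ ⟩
      χβ (suc m ∷ interval 1 l) μ
        ≡⟨ cong (λ xs → χβ (suc m ∷ xs) μ) (sym (++-identityʳ (interval 1 l))) ⟩
      χβ (suc m ∷ (interval 1 l ++ [])) μ
        ≡⟨ hookDegree m (m ∸ l) l (suc m) initialSegment-[] m+1≡ (sym (m∸n+n≡m l≤m)) ⟩
      + (m C l) ∎
      where
      m+1<head : suc m < head
      m+1<head = subst (suc m <_) target≡ (m<m+n (suc m) (s≤s z≤n))
      outside : ∀ {x} → x ∈ β → x ≤ suc m ⊎ head ≤ x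
      outside (here refl) = inj₂ ≤-refl
      outside (there x∈) = inj₁ (≤-trans (≤-pred (proj₂ (∈-interval⁻ 1 l x∈))) (m≤n⇒m≤1+n l≤m))
      m+1≡ : suc m ≡ suc (m ∸ l) + l + 0
      m+1≡ = sym (trans (+-identityʳ _) (cong suc (m∸n+n≡m l≤m)))

  countBetween-legRemoval : ∀ c l′ {t} → suc c ≤ t → countBetween 0 (suc c) (t ∷ interval 1 (l′ + suc c)) ≡ c
  countBetween-legRemoval c l′ {t} r≤t = begin
    countBetween 0 (suc c) (t ∷ interval 1 (l′ + suc c))
      ≡⟨ countBetween-∷-outside 0 (suc c) (interval 1 (l′ + suc c)) (inj₂ r≤t) ⟩
    countBetween 0 (suc c) (interval 1 (l′ + suc c))
      ≡⟨ cong (countBetween 0 (suc c)) (interval-+ 1 l′ (suc c)) ⟩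
    countBetween 0 (suc c) (upper ++ (suc c ∷ lower))
      ≡⟨ countBetween-++ 0 (suc c) upper (suc c ∷ lower) ⟩
    countBetween 0 (suc c) upper + countBetween 0 (suc c) (suc c ∷ lower)
      ≡⟨ cong₂ _+_ (countBetween-none 0 (suc c) upper
                      (λ x∈ → inj₂ (≤-trans (n≤1+n _) (proj₁ (∈-interval⁻ (suc (suc c)) l′ x∈)))))
                   (countBetween-∷-outside 0 (suc c) lower (inj₂ ≤-refl)) ⟩
    countBetween 0 (suc c) lower
      ≡⟨ countBetween-all 0 (suc c) lower (∈-interval⁻ 1 c) ⟩
    length lower
      ≡⟨ length-interval 1 c ⟩
    c ∎
    where
    upper = interval (suc (suc c)) l′
    lower = interval 1 c

  moveBead-legRemoval : ∀ c l′ {t} → suc c < t →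
    moveBead (suc c) 0 (t ∷ interval 1 (l′ + suc c)) ≡ t ∷ (interval (suc (suc c)) l′ ++ (0 ∷ interval 1 c))
  moveBead-legRemoval c l′ {t} r<t = begin
    moveBead (suc c) 0 (t ∷ interval 1 (l′ + suc c))
      ≡⟨ cong (λ xs → moveBead (suc c) 0 (t ∷ xs)) (interval-+ 1 l′ (suc c)) ⟩
    moveBead (suc c) 0 ((t ∷ upper) ++ (suc c ∷ lower))
      ≡⟨ map-++ _ (t ∷ upper) (suc c ∷ lower) ⟩
    moveBead (suc c) 0 (t ∷ upper) ++ moveBead (suc c) 0 (suc c ∷ lower)
      ≡⟨ cong₂ _++_ (moveBead-∉ 0 (t ∷ upper) (∉-∷ (<⇒≢ r<t) (∉-interval-< (suc (suc c)) l′ ≤-refl)))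
                    (moveBead-head 0 lower (∉-interval-≥ 1 c ≤-refl)) ⟩
    t ∷ (upper ++ (0 ∷ lower)) ∎
    where
    upper = interval (suc (suc c)) l′
    lower = interval 1 c

  hookCharacter-longLeg : ∀ c k l′ m → k + (l′ + suc c) ≡ suc c + m →
    sumℤ (map (removalTerm (suc k + (l′ + suc c) ∷ interval 1 (l′ + suc c)) (suc c) (replicate (suc m) 1))
              (interval 1 (l′ + suc c)))
      ≡ sgn c ℤ.* + (m C k)
  hookCharacter-longLeg c k l′ m k+l≡ = begin
    sumℤ (map f (interval 1 l))
      ≡⟨ cong (sumℤ ∘ map f) (interval-+ 1 l′ (suc c)) ⟩
    sumℤ (map f (upper ++ (suc c ∷ lower)))
      ≡⟨ sumℤ-++-zeroˡ f upper (suc c ∷ lower) upper-blocked ⟩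
    f (suc c) ℤ.+ sumℤ (map f lower)
      ≡⟨ cong₂ ℤ._+_ (removalTerm-move β (suc c) μ refl 0∉β)
                     (sumℤ-zero f lower (λ x∈ → removalTerm-< β (suc c) μ (proj₂ (∈-interval⁻ 1 c x∈)))) ⟩
    sgn (countBetween 0 (suc c) β) ℤ.* χβ (moveBead (suc c) 0 β) μ ℤ.+ 0ℤ
      ≡⟨ ℤ.+-identityʳ _ ⟩
    sgn (countBetween 0 (suc c) β) ℤ.* χβ (moveBead (suc c) 0 β) μ
      ≡⟨ cong₂ (λ n β′ → sgn n ℤ.* χβ β′ μ)
               (countBetween-legRemoval c l′ (<⇒≤ r<t)) (moveBead-legRemoval c l′ r<t) ⟩
    sgn c ℤ.* χβ (t ∷ (upper ++ (0 ∷ lower))) μ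
      ≡⟨ cong (sgn c ℤ.*_)
              (hookDegree m k l′ t (initialSegment-0∷interval c) (sym (+-assoc (suc k) l′ (suc c))) m≡k+l′) ⟩
    sgn c ℤ.* + (m C l′)
      ≡⟨ cong (λ n → sgn c ℤ.* + n)
              (subst (λ n → n C l′ ≡ n C k) (sym m≡k+l′) ([k+l]Cl≡[k+l]Ck k l′)) ⟩
    sgn c ℤ.* + (m C k) ∎
    where
    l = l′ + suc c
    t = suc k + l
    β = t ∷ interval 1 l
    μ = replicate (suc m) 1
    f = removalTerm β (suc c) μ
    upper = interval (suc (suc c)) l′
    lower = interval 1 c

    m≡k+l′ : m ≡ k + l′
    m≡k+l′ = sym (+-cancelʳ-≡ (suc c) (k + l′) m (trans (+-assoc k l′ (suc c)) (trans k+l≡ (+-comm (suc c) m))))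

    upper-blocked : ∀ {x} → x ∈ upper → f x ≡ 0ℤ
    upper-blocked x∈ with ∈-interval⇒offset (suc (suc c)) l′ x∈
    ... | i , i<l′ , refl = removalTerm-blocked β (suc c) μ (cong suc (trans (+-suc i c) (cong suc (+-comm i c))))
      (there (∈-interval⁺ 1 l (s≤s z≤n) (s≤s (<-≤-trans i<l′ (m≤m+n l′ (suc c))))))

    0∉β : 0 ∉ β
    0∉β = ∉-∷ (λ ()) (∉-interval-< 1 l (s≤s z≤n))

    r<t : suc c < t
    r<t = s≤s (≤-trans (m≤n+m (suc c) l′) (m≤n+m l k))

  hookCharacter-leg : ∀ c k l m → k + l ≡ suc c + m →
    sumℤ (map (removalTerm (suc k + l ∷ interval 1 l) (suc c) (replicate (suc m) 1)) (interval 1 l))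
      ≡ sgn c ℤ.* + (m C k)
  hookCharacter-leg c k l m k+l≡ with suc c ≤? l
  ... | yes r≤l with l ∸ suc c | m∸n+n≡m r≤l
  ...   | l′ | refl = hookCharacter-longLeg c k l′ m k+l≡
  hookCharacter-leg c k l m k+l≡ | no r≰l = begin
    sumℤ (map f (interval 1 l))
      ≡⟨ sumℤ-zero f (interval 1 l)
           (λ x∈ → removalTerm-< β (suc c) μ (<-≤-trans (proj₂ (∈-interval⁻ 1 l x∈)) l<r)) ⟩
    0ℤ
      ≡⟨ sym (ℤ.*-zeroʳ (sgn c)) ⟩
    sgn c ℤ.* 0ℤ
      ≡⟨ cong (λ n → sgn c ℤ.* + n) (sym (k>n⇒nCk≡0 m<k)) ⟩
    sgn c ℤ.* + (m C k) ∎
    where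
    β = suc k + l ∷ interval 1 l
    μ = replicate (suc m) 1
    f = removalTerm β (suc c) μ
    l<r : l < suc c
    l<r = ≰⇒> r≰l
    m<k : m < k
    m<k = +-cancelʳ-≤ l (suc m) k
            (≤-trans (+-monoʳ-≤ (suc m) (≤-pred l<r)) (≤-reflexive (trans (cong suc (+-comm m c)) (sym k+l≡))))

  hookCharacter : ∀ c k l m → k + l ≡ suc c + m →
    χβ (suc k + l ∷ interval 1 l) (suc c ∷ replicate (suc m) 1) ≡ + (m C l) ℤ.+ sgn c ℤ.* + (m C k)
  hookCharacter c k l m k+l≡ = cong₂ ℤ._+_ (hookCharacter-arm c k l m k+l≡) (hookCharacter-leg c k l m k+l≡)

  betaSet-replicate : ∀ c → betaSet (replicate c 1) ≡ interval 1 c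
  betaSet-replicate zero = refl
  betaSet-replicate (suc c) = cong₂ _∷_ (cong suc (length-replicate c)) (betaSet-replicate c)

  χ-hook : ∀ c m k → k ≤ c + suc m →
    χ (hook (suc c + suc m) (suc k)) (suc c ∷ replicate (suc m) 1) ≡ + (m C (c + suc m ∸ k)) ℤ.+ sgn c ℤ.* + (m C k)
  χ-hook c m k k≤n = begin
    χβ (suc k + length (replicate l 1) ∷ betaSet (replicate l 1)) μ
      ≡⟨ cong₂ (λ a β → χβ (suc k + a ∷ β) μ) (length-replicate l) (betaSet-replicate l) ⟩
    χβ (suc k + l ∷ interval 1 l) μ
      ≡⟨ hookCharacter c k l m (trans (m+[n∸m]≡n k≤n) (+-suc c m)) ⟩
    + (m C l) ℤ.+ sgn c ℤ.* + (m C k) ∎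
    where
    l = c + suc m ∸ k
    μ = suc c ∷ replicate (suc m) 1

  sumℤ-applyUpTo : ∀ (f : ℕ → ℤ) (g : ℕ → ℕ) n → (∀ {k} → k < n → f k ≡ + g k) →
                   sumℤ (applyUpTo f n) ≡ + ∑ n g
  sumℤ-applyUpTo f g zero _ = refl
  sumℤ-applyUpTo f g (suc n) f≡g = cong₂ ℤ._+_ (f≡g z<s) (sumℤ-applyUpTo (f ∘ suc) (g ∘ suc) n (f≡g ∘ s<s))

  hookSquareSum-closedForm : ∀ m → hookSquareSum (6 + m) ≡ + 2 ℤ.* (+ ((m + m) C m) ℤ.+ + ((m + m) C (5 + m)))
  hookSquareSum-closedForm m = begin
    sumℤ (map square (map suc (upTo n)))
      ≡⟨ cong sumℤ (trans (cong (map square) (map-applyUpTo id suc n)) (map-applyUpTo suc square n)) ⟩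
    sumℤ (applyUpTo (square ∘ suc) n)
      ≡⟨ sumℤ-applyUpTo (square ∘ suc) (λ k → value k * value k) n
           (λ {k} k<n → trans (cong (λ z → z ℤ.* z) (χ-value k<n)) (sym (ℤ.pos-* (value k) (value k)))) ⟩
    + ∑[ k < n ] (value k * value k)
      ≡⟨ cong +_ (∑-hookSquares 5 m) ⟩
    + (2 * ((m + m) C m + (m + m) C (5 + m)))
      ≡⟨ ℤ.pos-* 2 ((m + m) C m + (m + m) C (5 + m)) ⟩
    + 2 ℤ.* (+ ((m + m) C m) ℤ.+ + ((m + m) C (5 + m))) ∎
    where
    n = 6 + m
    square : ℕ → ℤ
    square j = χ (hook n j) (fiveCycleType n) ℤ.* χ (hook n j) (fiveCycleType n)
    value : ℕ → ℕ
    value k = m C (5 + m ∸ k) + m C k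
    χ-value : ∀ {k} → k < n → χ (hook n (suc k)) (fiveCycleType n) ≡ + value k
    χ-value {k} k<n =
      trans (χ-hook 4 m k (≤-pred k<n)) (cong (ℤ._+_ (+ (m C (5 + m ∸ k)))) (ℤ.*-identityˡ (+ (m C k))))

open import Data.Nat using (ℕ; _≤_; _∸_) renaming (_*_ to _*ℕ_)
open import Data.Nat.Combinatorics using (_C_)
open import Data.Integer using (ℤ; +_; _+_; _-_; _*_)
open import Relation.Binary.PropositionalEquality using (_≡_)
open import Data.Nat using (suc; zero; s≤s; z≤n) renaming (_+_ to _+ℕ_)
open import Data.Nat.Properties using (*-distribˡ-∸; +-identityʳ)
open import Data.Integer.Properties using (*-cancelˡ-≡; *-assoc; pos-*)
open import Data.Integer.Tactic.RingSolver using (solve; solve-∀)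
open import Data.List using (_∷_; [])
open import Relation.Binary.PropositionalEquality using (refl; sym; trans; cong; cong₂; module ≡-Reasoning)
open Binomials using ([k+1]*nC[k+1]+k*nCk≡n*nCk; [j+1]*[2j+2]C[j+1]≡2*[2j+1]*[2j]Cj)
open HookCharacters using (hookSquareSum-closedForm)
open ≡-Reasoning

∏ : ℕ → (ℕ → ℤ) → ℤ
∏ zero f = + 1
∏ (suc n) f = ∏ n f * f n

telescope : ∀ (a b x : ℕ → ℤ) → (∀ i → a i * x (suc i) ≡ b i * x i) →
            ∀ n → ∏ n a * x n ≡ ∏ n b * x 0
telescope a b x step zero = refl
telescope a b x step (suc n) = begin
  ∏ n a * a n * x (suc n)   ≡⟨ *-assoc (∏ n a) (a n) (x (suc n)) ⟩
  ∏ n a * (a n * x (suc n)) ≡⟨ cong (∏ n a *_) (step n) ⟩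
  ∏ n a * (b n * x n)       ≡⟨ swap (∏ n a) (b n) (x n) ⟩
  b n * (∏ n a * x n)       ≡⟨ cong (b n *_) (telescope a b x step n) ⟩
  b n * (∏ n b * x 0)       ≡⟨ swap (b n) (∏ n b) (x 0) ⟩
  ∏ n b * (b n * x 0)       ≡⟨ sym (*-assoc (∏ n b) (b n) (x 0)) ⟩
  ∏ n b * b n * x 0         ∎
  where
  swap : ∀ p q r → p * (q * r) ≡ q * (p * r)
  swap = solve-∀

binomial-ratio : ∀ n k → + suc k * + (n C suc k) ≡ (+ n - + k) * + (n C k)
binomial-ratio n k = cancel-+ʳ (+ suc k) (+ (n C suc k)) (+ k) (+ n) (+ (n C k)) (begin
  + suc k * + (n C suc k) + + k * + (n C k)
    ≡⟨ cong₂ _+_ (sym (pos-* (suc k) (n C suc k))) (sym (pos-* k (n C k))) ⟩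
  + (suc k *ℕ (n C suc k) +ℕ k *ℕ (n C k))
    ≡⟨ cong +_ ([k+1]*nC[k+1]+k*nCk≡n*nCk n k) ⟩
  + (n *ℕ (n C k))
    ≡⟨ pos-* n (n C k) ⟩
  + n * + (n C k) ∎)
  where
  cancel-+ʳ : ∀ a y k n x → a * y + k * x ≡ n * x → a * y ≡ (n - k) * x
  cancel-+ʳ a y k n x eq = begin
    a * y                 ≡⟨ solve (a ∷ y ∷ k ∷ x ∷ []) ⟩
    a * y + k * x - k * x ≡⟨ cong (_- k * x) eq ⟩
    n * x - k * x         ≡⟨ solve (n ∷ k ∷ x ∷ []) ⟩
    (n - k) * x           ∎

central-ratio : ∀ j → + suc j * + ((suc j +ℕ suc j) C suc j) ≡ + 2 * + suc (j +ℕ j) * + ((j +ℕ j) C j)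
central-ratio j = begin
  + suc j * + ((suc j +ℕ suc j) C suc j)
    ≡⟨ sym (pos-* (suc j) ((suc j +ℕ suc j) C suc j)) ⟩
  + (suc j *ℕ ((suc j +ℕ suc j) C suc j))
    ≡⟨ cong +_ ([j+1]*[2j+2]C[j+1]≡2*[2j+1]*[2j]Cj j) ⟩
  + (2 *ℕ suc (j +ℕ j) *ℕ ((j +ℕ j) C j))
    ≡⟨ pos-* (2 *ℕ suc (j +ℕ j)) ((j +ℕ j) C j) ⟩
  + (2 *ℕ suc (j +ℕ j)) * + ((j +ℕ j) C j)
    ≡⟨ cong (_* + ((j +ℕ j) C j)) (pos-* 2 (suc (j +ℕ j))) ⟩
  + 2 * + suc (j +ℕ j) * + ((j +ℕ j) C j) ∎

-- INLINE lets the ring solver see through these abbreviations.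
rising₅ : ℤ → ℤ
rising₅ x = (+ 1 + x) * (+ 2 + x) * (+ 3 + x) * (+ 4 + x) * (+ 5 + x)
{-# INLINE rising₅ #-}

falling₅ : ℤ → ℤ
falling₅ x = x * (x - + 1) * (x - + 2) * (x - + 3) * (x - + 4)
{-# INLINE falling₅ #-}

oddRising₅ : ℤ → ℤ
oddRising₅ x = (+ 2 * x + + 1) * (+ 2 * x + + 3) * (+ 2 * x + + 5) * (+ 2 * x + + 7) * (+ 2 * x + + 9)
{-# INLINE oddRising₅ #-}

lhsFactor : ℤ → ℤ
lhsFactor n = (+ 16) * ((+ 2 * n - + 3) * (+ 2 * n - + 5) * (+ 2 * n - + 7) * (+ 2 * n - + 9))
{-# INLINE lhsFactor #-}

quartic : ℤ → ℤ
quartic n = (n * n * n * n) - + 22 * (n * n * n) + + 239 * (n * n) - + 1298 * n + + 2760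
{-# INLINE quartic #-}

rising₅-as-∏ : ∀ M → + 1 * (+ 1 + M) * (+ 2 + M) * (+ 3 + M) * (+ 4 + M) * (+ 5 + M) ≡ rising₅ M
rising₅-as-∏ = solve-∀

binomial-ratio₅ : ∀ m → rising₅ (+ m) * + ((m +ℕ m) C (5 +ℕ m)) ≡ falling₅ (+ m) * + ((m +ℕ m) C m)
binomial-ratio₅ m = begin
  rising₅ (+ m) * x 5   ≡⟨ cong (_* x 5) (sym (rising₅-as-∏ (+ m))) ⟩
  ∏ 5 a * x 5           ≡⟨ telescope a b x (λ i → binomial-ratio (m +ℕ m) (i +ℕ m)) 5 ⟩
  ∏ 5 b * x 0           ≡⟨ cong (_* x 0) (differences (+ m)) ⟩
  falling₅ (+ m) * x 0  ∎
  where
  a b x : ℕ → ℤ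
  a i = + suc (i +ℕ m)
  b i = + (m +ℕ m) - + (i +ℕ m)
  x i = + ((m +ℕ m) C (i +ℕ m))
  differences : ∀ M → + 1 * (M + M - M) * (M + M - (+ 1 + M)) * (M + M - (+ 2 + M))
                          * (M + M - (+ 3 + M)) * (M + M - (+ 4 + M)) ≡ falling₅ M
  differences = solve-∀

central-ratio₅ : ∀ m →
  rising₅ (+ m) * + ((5 +ℕ m +ℕ (5 +ℕ m)) C (5 +ℕ m)) ≡ + 32 * oddRising₅ (+ m) * + ((m +ℕ m) C m)
central-ratio₅ m = begin
  rising₅ (+ m) * x 5   ≡⟨ cong (_* x 5) (sym (rising₅-as-∏ (+ m))) ⟩
  ∏ 5 a * x 5           ≡⟨ telescope a b x (λ i → central-ratio (i +ℕ m)) 5 ⟩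
  ∏ 5 b * x 0           ≡⟨ cong (_* x 0) (doubled-odds (+ m)) ⟩
  + 32 * oddRising₅ (+ m) * x 0  ∎
  where
  a b x : ℕ → ℤ
  a i = + suc (i +ℕ m)
  b i = + 2 * + suc (i +ℕ m +ℕ (i +ℕ m))
  x i = + ((i +ℕ m +ℕ (i +ℕ m)) C (i +ℕ m))
  doubled-odds : ∀ M → + 1 * (+ 2 * (+ 1 + (M + M))) * (+ 2 * (+ 1 + ((+ 1 + M) + (+ 1 + M))))
                           * (+ 2 * (+ 1 + ((+ 2 + M) + (+ 2 + M)))) * (+ 2 * (+ 1 + ((+ 3 + M) + (+ 3 + M))))
                           * (+ 2 * (+ 1 + ((+ 4 + M) + (+ 4 + M)))) ≡ + 32 * oddRising₅ M
  doubled-odds = solve-∀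

quartic-identity : ∀ M → (+ 2 * M + + 1) * quartic (+ 6 + M) ≡ rising₅ M + falling₅ M
quartic-identity = solve-∀

closedForm-scaled : ∀ M X Z Y → rising₅ M * Z ≡ falling₅ M * X → rising₅ M * Y ≡ + 32 * oddRising₅ M * X →
  rising₅ M * (lhsFactor (+ 6 + M) * (+ 2 * (X + Z))) ≡ rising₅ M * (quartic (+ 6 + M) * Y)
closedForm-scaled M X Z Y z-ratio y-ratio = begin
  rising₅ M * (lhsFactor (+ 6 + M) * (+ 2 * (X + Z)))
    ≡⟨ solve (M ∷ X ∷ Z ∷ []) ⟩
  + 2 * lhsFactor (+ 6 + M) * (rising₅ M * X + rising₅ M * Z)
    ≡⟨ cong (λ w → + 2 * lhsFactor (+ 6 + M) * (rising₅ M * X + w)) z-ratio ⟩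
  + 2 * lhsFactor (+ 6 + M) * (rising₅ M * X + falling₅ M * X)
    ≡⟨ solve (M ∷ X ∷ []) ⟩
  + 2 * lhsFactor (+ 6 + M) * ((rising₅ M + falling₅ M) * X)
    ≡⟨ cong (λ w → + 2 * lhsFactor (+ 6 + M) * (w * X)) (sym (quartic-identity M)) ⟩
  + 2 * lhsFactor (+ 6 + M) * ((+ 2 * M + + 1) * quartic (+ 6 + M) * X)
    ≡⟨ solve (M ∷ X ∷ []) ⟩
  quartic (+ 6 + M) * (+ 32 * oddRising₅ M * X)
    ≡⟨ cong (quartic (+ 6 + M) *_) (sym y-ratio) ⟩
  quartic (+ 6 + M) * (rising₅ M * Y)
    ≡⟨ solve (M ∷ Y ∷ []) ⟩
  rising₅ M * (quartic (+ 6 + M) * Y) ∎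

closedForm : ∀ m {H X Z Y : ℤ} → H ≡ + 2 * (X + Z) →
  rising₅ (+ m) * Z ≡ falling₅ (+ m) * X → rising₅ (+ m) * Y ≡ + 32 * oddRising₅ (+ m) * X →
  lhsFactor (+ 6 + + m) * H ≡ quartic (+ 6 + + m) * Y
closedForm m {X = X} {Z} {Y} refl z-ratio y-ratio =
  *-cancelˡ-≡ (rising₅ (+ m)) _ _ (closedForm-scaled (+ m) X Z Y z-ratio y-ratio)

2*[1+k]∸2≡k+k : ∀ k → 2 *ℕ suc k ∸ 2 ≡ k +ℕ k
2*[1+k]∸2≡k+k k = trans (sym (*-distribˡ-∸ 2 (suc k) 1)) (cong (k +ℕ_) (+-identityʳ k))

mainTheorem8 : (n : ℕ) → 5 ≤ n →
    (+ 16) * ((+ 2 * + n - + 3) * (+ 2 * + n - + 5) * (+ 2 * + n - + 7) * (+ 2 * + n - + 9)) * hookSquareSum n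
      ≡ ((+ n * + n * + n * + n) - + 22 * (+ n * + n * + n) + + 239 * (+ n * + n) - + 1298 * + n + + 2760)
        * (+ ((2 *ℕ n ∸ 2) C (n ∸ 1)))
mainTheorem8 _ (s≤s (s≤s (s≤s (s≤s (s≤s (z≤n {zero})))))) = refl
mainTheorem8 _ (s≤s (s≤s (s≤s (s≤s (s≤s (z≤n {suc m})))))) =
  closedForm m (hookSquareSum-closedForm m) (binomial-ratio₅ m) central
  where
  central : rising₅ (+ m) * + ((2 *ℕ (6 +ℕ m) ∸ 2) C (5 +ℕ m)) ≡ + 32 * oddRising₅ (+ m) * + ((m +ℕ m) C m)
  central = trans (cong (λ N → rising₅ (+ m) * + (N C (5 +ℕ m))) (2*[1+k]∸2≡k+k (5 +ℕ m))) (central-ratio₅ m)
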